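{- For every integer $n\geq 0$ and every integer $j\geq 1$, $$\sum_{k=0}^n\binom{n}{k}(\sqrt{5}F_j)^{n-k}\bigl(2^{1-(n-k)}-1\bigr)F_{jk}\,B_{n-k} = n\,2^{1-n}F_jL_j^{n-1}.$$
   Context: $B_n$ denotes the $n$-th Bernoulli number, defined by $\sum_{n\ge0}B_n\frac{z^n}{n!}=\frac{z}{e^z-1}$ (so $B_1=-1/2$). $F_n$ and $L_n$ are the Fibonacci and Lucas numbers: $F_0=0,F_1=1$, $L_0=2,L_1=1$, and $X_n=X_{n-1}+X_{n-2}$ for $n\ge2$. For $n=0$ the right-hand side, which carries the factor $n$, is interpreted as $0$. -}

module Defs where

open import Data.Nat as ℕ using (ℕ; zero; suc; _∸_)
open import Data.Nat.Combinatorics using (_C_)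
open import Data.Integer using (+_)
import Data.Rational as ℚ
open ℚ using (ℚ; 0ℚ; 1ℚ; _/_)
open import Data.List using (List; []; _∷_; _++_; [_]; length; lookup)
open import Data.Fin using (Fin)

fib : ℕ → ℕ
fib 0 = 0
fib 1 = 1
fib (suc (suc n)) = fib (suc n) ℕ.+ fib n

lucas : ℕ → ℕ
lucas 0 = 2
lucas 1 = 1
lucas (suc (suc n)) = lucas (suc n) ℕ.+ lucas n

toℚ : ℕ → ℚ
toℚ n = (+ n) / 1

_^ℚ_ : ℚ → ℕ → ℚ
q ^ℚ zero  = 1ℚ
q ^ℚ suc k = q ℚ.* (q ^ℚ k)

two^[1-_] : ℕ → ℚ
two^[1- zero  ] = toℚ 2
two^[1- suc m ] = ((+ 1) / 2) ^ℚ m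

-- Bernoulli numbers (convention B₁ = -1/2), from the generating function
-- z/(e^z - 1) = Σ B_n z^n/n!.  Comparing coefficients of z^(m+1) in
-- (e^z - 1) · Σ B_n z^n/n! = z gives, for m ≥ 1,
--   Σ_{k=0}^{m} C(m+1,k) B_k = 0, and B_0 = 1.
-- bernList n = [B_0, …, B_n]
private
  weighted : ℕ → ℕ → List ℚ → ℚ
  weighted m k []       = 0ℚ
  weighted m k (b ∷ bs) = toℚ ((suc m) C k) ℚ.* b ℚ.+ weighted m (suc k) bs

bernList : ℕ → List ℚ
bernList zero    = [ 1ℚ ]
bernList (suc n) = bs ++ [ ℚ.- (((+ 1) / (suc (suc n))) ℚ.* weighted (suc n) 0 bs) ]
  where bs = bernList n

nth : List ℚ → ℕ → ℚ
nth []       _       = 0ℚ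
nth (x ∷ xs) zero    = x
nth (x ∷ xs) (suc k) = nth xs k

bernoulli : ℕ → ℚ
bernoulli n = nth (bernList n) n

record ℚ√5 : Set where
  constructor _+_·√5
  field
    re : ℚ
    ir : ℚ

infixl 6 _⊕_
infixl 7 _⊗_
infixr 8 _^√_

_⊕_ : ℚ√5 → ℚ√5 → ℚ√5
(a + b ·√5) ⊕ (c + d ·√5) = (a ℚ.+ c) + (b ℚ.+ d) ·√5

_⊗_ : ℚ√5 → ℚ√5 → ℚ√5
(a + b ·√5) ⊗ (c + d ·√5) =
  (a ℚ.* c ℚ.+ toℚ 5 ℚ.* (b ℚ.* d)) + (a ℚ.* d ℚ.+ b ℚ.* c) ·√5

ι : ℚ → ℚ√5
ι q = q + 0ℚ ·√5

√5 : ℚ√5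
√5 = 0ℚ + 1ℚ ·√5

_^√_ : ℚ√5 → ℕ → ℚ√5
x ^√ zero  = ι 1ℚ
x ^√ suc k = x ⊗ (x ^√ k)

sumTo : ℕ → (ℕ → ℚ√5) → ℚ√5
sumTo zero    f = f 0
sumTo (suc n) f = sumTo n f ⊕ f (suc n)

open import Relation.Binary.PropositionalEquality using (_≡_; refl)
open import Data.Integer using (-[1+_])
_ : bernoulli 1 ≡ -[1+ 0 ] / 2
_ = refl
_ : bernoulli 2 ≡ (+ 1) / 6
_ = refl
_ : bernoulli 3 ≡ 0ℚ
_ = refl
_ : bernoulli 4 ≡ -[1+ 0 ] / 30
_ = refl

-- Write Pₙ(g; x) = Σₖ C(n,k) B_{n−k} g^{n−k} xᵏ = gⁿ Bₙ(x/g).  The Bernoulli recurrence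
-- Σₜ C(m,t) B_{m−t} = B_m + [m = 1] turns the binomial expansion of Pₙ(g; x + g) into the
-- difference equation Pₙ(g; x + g) − Pₙ(g; x) = n g x^{n−1}.
-- Put u = φʲ, v = ψʲ and h = u − v = √5 Fⱼ, so that √5 F_{jk} = uᵏ − vᵏ.  Then √5 times the
-- left-hand side is 2[Pₙ(h/2; u) − Pₙ(h/2; v)] − [Pₙ(h; u) − Pₙ(h; v)]; the difference
-- equation, used twice with step h/2 and once with step h, leaves n h ((u + v)/2)^{n−1},
-- and u + v = Lⱼ.
module Submission where

open import Defs
open import Data.Nat using (ℕ; _∸_; _*_; _≥_)
open import Data.Nat.Combinatorics using (_C_)
open import Data.Rational using (_-_; 1ℚ)
open import Relation.Binary.PropositionalEquality using (_≡_)

open import Algebra.Bundles using (CommutativeRing)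
open import Data.Fin using (toℕ)
open import Data.Integer as ℤ using (+_)
import Data.Integer.Properties as ℤ
open import Data.List using (List; []; _∷_; _++_; [_]; length)
import Data.List.Properties as List
open import Data.Nat using (zero; suc; _+_; _≤_; _<_; z≤n; s≤s; _!)
import Data.Nat.Properties as ℕ
open import Data.Nat.Properties using (_!≢0; _!*_!≢0)
open import Data.Nat.Combinatorics
  using (nCk≡nC[n∸k]; nCn≡1; nC1≡n; nCk≡n!/k![n-k]!; k![n∸k]!∣n!)
open import Data.Nat.Coprimality using (1-coprimeTo)
import Data.Nat.Coprimality as Coprime
open import Data.Nat.DivMod using (m/n*n≡m)
open import Data.Nat.Tactic.RingSolver using () renaming (ring to ℕ-ring)
open import Data.Product using (Σ-syntax; _,_; proj₁)
open import Data.Rational as ℚ using (ℚ; 0ℚ; mkℚ)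
import Data.Rational.Properties as ℚ
open import Data.Sum using (inj₁; inj₂)
open import Function using (_∘_)
open import Relation.Binary.Definitions using (DecidableEquality)
open import Relation.Binary.PropositionalEquality
  using (refl; sym; trans; cong; cong₂; subst; isEquivalence)
open import Relation.Binary.PropositionalEquality.Properties using (module ≡-Reasoning)
open import Relation.Nullary.Decidable using (map′; _×-dec_; dec⇒maybe)
open import Tactic.RingSolver using (solve-∀)
import Tactic.RingSolver.Core.AlmostCommutativeRing as ACR

open ≡-Reasoning

ℚ-ring : ACR.AlmostCommutativeRing _ _
ℚ-ring = ACR.fromCommutativeRing ℚ.+-*-commutativeRing λ x → dec⇒maybe (0ℚ ℚ.≟ x)

infix 8 ⊖_

⊖_ : ℚ√5 → ℚ√5
⊖ (a + b ·√5) = (ℚ.- a) + (ℚ.- b) ·√5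

𝟘 𝟙 : ℚ√5
𝟘 = ι 0ℚ
𝟙 = ι 1ℚ

⊕-assoc : ∀ x y z → (x ⊕ y) ⊕ z ≡ x ⊕ (y ⊕ z)
⊕-assoc (a + b ·√5) (c + d ·√5) (e + f ·√5) = cong₂ _+_·√5 (ℚ.+-assoc a c e) (ℚ.+-assoc b d f)

⊕-comm : ∀ x y → x ⊕ y ≡ y ⊕ x
⊕-comm (a + b ·√5) (c + d ·√5) = cong₂ _+_·√5 (ℚ.+-comm a c) (ℚ.+-comm b d)

⊕-identityˡ : ∀ x → 𝟘 ⊕ x ≡ x
⊕-identityˡ (a + b ·√5) = cong₂ _+_·√5 (ℚ.+-identityˡ a) (ℚ.+-identityˡ b)

⊕-identityʳ : ∀ x → x ⊕ 𝟘 ≡ x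
⊕-identityʳ x = trans (⊕-comm x 𝟘) (⊕-identityˡ x)

⊖-inverseˡ : ∀ x → ⊖ x ⊕ x ≡ 𝟘
⊖-inverseˡ (a + b ·√5) = cong₂ _+_·√5 (ℚ.+-inverseˡ a) (ℚ.+-inverseˡ b)

⊖-inverseʳ : ∀ x → x ⊕ ⊖ x ≡ 𝟘
⊖-inverseʳ x = trans (⊕-comm x (⊖ x)) (⊖-inverseˡ x)

⊗-comm : ∀ x y → x ⊗ y ≡ y ⊗ x
⊗-comm (a + b ·√5) (c + d ·√5) = cong₂ _+_·√5 (re a b c d (toℚ 5)) (ir a b c d)
  where
  re : ∀ a b c d k → a ℚ.* c ℚ.+ k ℚ.* (b ℚ.* d) ≡ c ℚ.* a ℚ.+ k ℚ.* (d ℚ.* b)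
  re = solve-∀ ℚ-ring
  ir : ∀ a b c d → a ℚ.* d ℚ.+ b ℚ.* c ≡ c ℚ.* b ℚ.+ d ℚ.* a
  ir = solve-∀ ℚ-ring

⊗-assoc : ∀ x y z → (x ⊗ y) ⊗ z ≡ x ⊗ (y ⊗ z)
⊗-assoc (a + b ·√5) (c + d ·√5) (e + f ·√5) = cong₂ _+_·√5 (re a b c d e f (toℚ 5)) (ir a b c d e f (toℚ 5))
  where
  re : ∀ a b c d e f k →
    (a ℚ.* c ℚ.+ k ℚ.* (b ℚ.* d)) ℚ.* e ℚ.+ k ℚ.* ((a ℚ.* d ℚ.+ b ℚ.* c) ℚ.* f)
      ≡ a ℚ.* (c ℚ.* e ℚ.+ k ℚ.* (d ℚ.* f)) ℚ.+ k ℚ.* (b ℚ.* (c ℚ.* f ℚ.+ d ℚ.* e))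
  re = solve-∀ ℚ-ring
  ir : ∀ a b c d e f k →
    (a ℚ.* c ℚ.+ k ℚ.* (b ℚ.* d)) ℚ.* f ℚ.+ (a ℚ.* d ℚ.+ b ℚ.* c) ℚ.* e
      ≡ a ℚ.* (c ℚ.* f ℚ.+ d ℚ.* e) ℚ.+ b ℚ.* (c ℚ.* e ℚ.+ k ℚ.* (d ℚ.* f))
  ir = solve-∀ ℚ-ring

⊗-identityˡ : ∀ x → 𝟙 ⊗ x ≡ x
⊗-identityˡ (a + b ·√5) = cong₂ _+_·√5 (re a b (toℚ 5)) (ir a b)
  where
  re : ∀ a b k → 1ℚ ℚ.* a ℚ.+ k ℚ.* (0ℚ ℚ.* b) ≡ a
  re = solve-∀ ℚ-ring
  ir : ∀ a b → 1ℚ ℚ.* b ℚ.+ 0ℚ ℚ.* a ≡ b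
  ir = solve-∀ ℚ-ring

⊗-identityʳ : ∀ x → x ⊗ 𝟙 ≡ x
⊗-identityʳ x = trans (⊗-comm x 𝟙) (⊗-identityˡ x)

⊗-distribˡ-⊕ : ∀ x y z → x ⊗ (y ⊕ z) ≡ x ⊗ y ⊕ x ⊗ z
⊗-distribˡ-⊕ (a + b ·√5) (c + d ·√5) (e + f ·√5) = cong₂ _+_·√5 (re a b c d e f (toℚ 5)) (ir a b c d e f)
  where
  re : ∀ a b c d e f k → a ℚ.* (c ℚ.+ e) ℚ.+ k ℚ.* (b ℚ.* (d ℚ.+ f))
    ≡ (a ℚ.* c ℚ.+ k ℚ.* (b ℚ.* d)) ℚ.+ (a ℚ.* e ℚ.+ k ℚ.* (b ℚ.* f))
  re = solve-∀ ℚ-ring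
  ir : ∀ a b c d e f → a ℚ.* (d ℚ.+ f) ℚ.+ b ℚ.* (c ℚ.+ e) ≡ (a ℚ.* d ℚ.+ b ℚ.* c) ℚ.+ (a ℚ.* f ℚ.+ b ℚ.* e)
  ir = solve-∀ ℚ-ring

⊗-distribʳ-⊕ : ∀ x y z → (y ⊕ z) ⊗ x ≡ y ⊗ x ⊕ z ⊗ x
⊗-distribʳ-⊕ x y z = trans (⊗-comm (y ⊕ z) x) (trans (⊗-distribˡ-⊕ x y z) (cong₂ _⊕_ (⊗-comm x y) (⊗-comm x z)))

ℚ√5-commutativeRing : CommutativeRing _ _
ℚ√5-commutativeRing = record
  { Carrier = ℚ√5 ; _≈_ = _≡_ ; _+_ = _⊕_ ; _*_ = _⊗_ ; -_ = ⊖_ ; 0# = 𝟘 ; 1# = 𝟙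
  ; isCommutativeRing = record
    { isRing = record
      { +-isAbelianGroup = record
        { isGroup = record
          { isMonoid = record
            { isSemigroup = record
              { isMagma = record { isEquivalence = isEquivalence ; ∙-cong = cong₂ _⊕_ }
              ; assoc = ⊕-assoc }
            ; identity = ⊕-identityˡ , ⊕-identityʳ }
          ; inverse = ⊖-inverseˡ , ⊖-inverseʳ
          ; ⁻¹-cong = cong ⊖_ }
        ; comm = ⊕-comm }
      ; *-cong = cong₂ _⊗_
      ; *-assoc = ⊗-assoc
      ; *-identity = ⊗-identityˡ , ⊗-identityʳ
      ; distrib = ⊗-distribˡ-⊕ , ⊗-distribʳ-⊕ }
    ; *-comm = ⊗-comm } }

_≟√5_ : DecidableEquality ℚ√5
(a + b ·√5) ≟√5 (c + d ·√5) =
  map′ (λ (p , q) → cong₂ _+_·√5 p q) (λ { refl → refl , refl }) ((a ℚ.≟ c) ×-dec (b ℚ.≟ d))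

ℚ√5-ring : ACR.AlmostCommutativeRing _ _
ℚ√5-ring = ACR.fromCommutativeRing ℚ√5-commutativeRing λ x → dec⇒maybe (𝟘 ≟√5 x)


open CommutativeRing ℚ√5-commutativeRing using (commutativeSemiring; semiring)
open import Algebra.Properties.CommutativeSemiring.Exp commutativeSemiring
  using (_^_; ^-homo-*; ^-assocʳ; ^-distrib-*)
open import Algebra.Properties.Semiring.Mult semiring using (_×_)
open import Algebra.Properties.Semiring.Sum semiring using (sum⁺-syntax; sum-cong-≗)
import Algebra.Properties.CommutativeSemiring.Binomial commutativeSemiring as Binomial

toℚ≡mkℚ : ∀ n → toℚ n ≡ mkℚ (+ n) 0 (Coprime.sym (1-coprimeTo n))
toℚ≡mkℚ n = ℚ.normalize-coprime (Coprime.sym (1-coprimeTo n))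

toℚ-homo-+ : ∀ m n → toℚ (m + n) ≡ toℚ m ℚ.+ toℚ n
toℚ-homo-+ m n rewrite toℚ≡mkℚ m | toℚ≡mkℚ n = cong (ℚ._/ 1) (begin
  + (m + n)                    ≡⟨ ℤ.pos-+ m n ⟩
  + m ℤ.+ + n                  ≡⟨ sym (cong₂ ℤ._+_ (ℤ.*-identityʳ (+ m)) (ℤ.*-identityʳ (+ n))) ⟩
  + m ℤ.* + 1 ℤ.+ + n ℤ.* + 1  ∎)

toℚ-homo-* : ∀ m n → toℚ (m * n) ≡ toℚ m ℚ.* toℚ n
toℚ-homo-* m n rewrite toℚ≡mkℚ m | toℚ≡mkℚ n = cong (ℚ._/ 1) (ℤ.pos-* m n)

fromℕ : ℕ → ℚ√5
fromℕ n = ι (toℚ n)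

ι-homo-* : ∀ a b → ι (a ℚ.* b) ≡ ι a ⊗ ι b
ι-homo-* a b = cong₂ _+_·√5 (re a b (toℚ 5)) (ir a b)
  where
  re : ∀ a b k → a ℚ.* b ≡ a ℚ.* b ℚ.+ k ℚ.* (0ℚ ℚ.* 0ℚ)
  re = solve-∀ ℚ-ring
  ir : ∀ a b → 0ℚ ≡ a ℚ.* 0ℚ ℚ.+ 0ℚ ℚ.* b
  ir = solve-∀ ℚ-ring

fromℕ-homo-+ : ∀ m n → fromℕ (m + n) ≡ fromℕ m ⊕ fromℕ n
fromℕ-homo-+ m n = cong ι (toℚ-homo-+ m n)

fromℕ-homo-* : ∀ m n → fromℕ (m * n) ≡ fromℕ m ⊗ fromℕ n
fromℕ-homo-* m n = trans (cong ι (toℚ-homo-* m n)) (ι-homo-* (toℚ m) (toℚ n))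

^√≗^ : ∀ x n → x ^√ n ≡ x ^ n
^√≗^ x zero    = refl
^√≗^ x (suc n) = cong (x ⊗_) (^√≗^ x n)

^√-homo-⊗ : ∀ x m n → x ^√ (m + n) ≡ x ^√ m ⊗ x ^√ n
^√-homo-⊗ x m n rewrite ^√≗^ x (m + n) | ^√≗^ x m | ^√≗^ x n = ^-homo-* x m n

^√-assocʳ : ∀ x m n → (x ^√ m) ^√ n ≡ x ^√ (m * n)
^√-assocʳ x m n rewrite ^√≗^ (x ^√ m) n | ^√≗^ x m | ^√≗^ x (m * n) = ^-assocʳ x m n

^√-distrib-⊗ : ∀ x y n → (x ⊗ y) ^√ n ≡ x ^√ n ⊗ y ^√ n
^√-distrib-⊗ x y n rewrite ^√≗^ (x ⊗ y) n | ^√≗^ x n | ^√≗^ y n = ^-distrib-* x y n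

ι-homo-^ : ∀ q m → ι (q ^ℚ m) ≡ ι q ^√ m
ι-homo-^ q zero    = refl
ι-homo-^ q (suc m) = trans (ι-homo-* q (q ^ℚ m)) (cong (ι q ⊗_) (ι-homo-^ q m))

×≗fromℕ⊗ : ∀ m x → m × x ≡ fromℕ m ⊗ x
×≗fromℕ⊗ zero    x = sym (zeroˡ x)
  where
  zeroˡ : ∀ x → 𝟘 ⊗ x ≡ 𝟘
  zeroˡ = solve-∀ ℚ√5-ring
×≗fromℕ⊗ (suc m) x = begin
  x ⊕ m × x            ≡⟨ cong₂ _⊕_ (sym (⊗-identityˡ x)) (×≗fromℕ⊗ m x) ⟩
  𝟙 ⊗ x ⊕ fromℕ m ⊗ x  ≡⟨ sym (⊗-distribʳ-⊕ x 𝟙 (fromℕ m)) ⟩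
  (𝟙 ⊕ fromℕ m) ⊗ x    ≡⟨ cong (_⊗ x) (sym (fromℕ-homo-+ 1 m)) ⟩
  fromℕ (suc m) ⊗ x    ∎

sumTo-cong : ∀ n {f g : ℕ → ℚ√5} → (∀ k → k ≤ n → f k ≡ g k) → sumTo n f ≡ sumTo n g
sumTo-cong zero    f≗g = f≗g 0 z≤n
sumTo-cong (suc n) f≗g =
  cong₂ _⊕_ (sumTo-cong n (λ k k≤n → f≗g k (ℕ.m≤n⇒m≤1+n k≤n))) (f≗g (suc n) ℕ.≤-refl)

sumTo-suc : ∀ n (f : ℕ → ℚ√5) → sumTo (suc n) f ≡ f 0 ⊕ sumTo n (f ∘ suc)
sumTo-suc zero    f = refl
sumTo-suc (suc n) f = trans (cong (_⊕ f (suc (suc n))) (sumTo-suc n f))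
  (⊕-assoc (f 0) (sumTo n (f ∘ suc)) (f (suc (suc n))))

sumTo≡∑ : ∀ n (f : ℕ → ℚ√5) → sumTo n f ≡ ∑[ k ≤ n ] f (toℕ k)
sumTo≡∑ zero    f = sym (⊕-identityʳ (f 0))
sumTo≡∑ (suc n) f = trans (sumTo-suc n f) (cong (f 0 ⊕_) (sumTo≡∑ n (f ∘ suc)))

binomialTerm : ℕ → ℚ√5 → ℚ√5 → ℕ → ℚ√5
binomialTerm n x y k = fromℕ (n C k) ⊗ (x ^√ k ⊗ y ^√ (n ∸ k))

binomial : ∀ n x y → (x ⊕ y) ^√ n ≡ sumTo n (binomialTerm n x y)
binomial n x y = begin
  (x ⊕ y) ^√ n                           ≡⟨ ^√≗^ (x ⊕ y) n ⟩
  (x ⊕ y) ^ n                            ≡⟨ Binomial.theorem n x y ⟩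
  Binomial.binomialExpansion x y n       ≡⟨ sum-cong-≗ {suc n} (λ k → term (toℕ k)) ⟩
  ∑[ k ≤ n ] binomialTerm n x y (toℕ k)  ≡⟨ sym (sumTo≡∑ n (binomialTerm n x y)) ⟩
  sumTo n (binomialTerm n x y)           ∎
  where
  term : ∀ k → (n C k) × (x ^ k ⊗ y ^ (n ∸ k)) ≡ binomialTerm n x y k
  term k rewrite ^√≗^ x k | ^√≗^ y (n ∸ k) = ×≗fromℕ⊗ (n C k) (x ^ k ⊗ y ^ (n ∸ k))

sumTo-⊕ : ∀ n (f g : ℕ → ℚ√5) → sumTo n (λ k → f k ⊕ g k) ≡ sumTo n f ⊕ sumTo n g
sumTo-⊕ zero    f g = refl
sumTo-⊕ (suc n) f g = trans (cong (_⊕ (f (suc n) ⊕ g (suc n))) (sumTo-⊕ n f g))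
  (interchange (sumTo n f) (sumTo n g) (f (suc n)) (g (suc n)))
  where
  interchange : ∀ a b c d → (a ⊕ b) ⊕ (c ⊕ d) ≡ (a ⊕ c) ⊕ (b ⊕ d)
  interchange = solve-∀ ℚ√5-ring

sumTo-⊗ˡ : ∀ n c (f : ℕ → ℚ√5) → sumTo n (λ k → c ⊗ f k) ≡ c ⊗ sumTo n f
sumTo-⊗ˡ zero    c f = refl
sumTo-⊗ˡ (suc n) c f = trans (cong (_⊕ c ⊗ f (suc n)) (sumTo-⊗ˡ n c f))
  (sym (⊗-distribˡ-⊕ c (sumTo n f) (f (suc n))))

sumTo-⊖ : ∀ n (f : ℕ → ℚ√5) → sumTo n (λ k → ⊖ f k) ≡ ⊖ sumTo n f
sumTo-⊖ zero    f = refl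
sumTo-⊖ (suc n) f = trans (cong (_⊕ ⊖ f (suc n)) (sumTo-⊖ n f)) (sym (⊖-distrib-⊕ (sumTo n f) (f (suc n))))
  where
  ⊖-distrib-⊕ : ∀ a b → ⊖ (a ⊕ b) ≡ ⊖ a ⊕ ⊖ b
  ⊖-distrib-⊕ = solve-∀ ℚ√5-ring

sumTo-reverse : ∀ n (f : ℕ → ℚ√5) → sumTo n f ≡ sumTo n (λ k → f (n ∸ k))
sumTo-reverse zero    f = refl
sumTo-reverse (suc n) f = begin
  sumTo n f ⊕ f (suc n)                  ≡⟨ cong (_⊕ f (suc n)) (sumTo-reverse n f) ⟩
  sumTo n (λ k → f (n ∸ k)) ⊕ f (suc n)  ≡⟨ ⊕-comm (sumTo n (λ k → f (n ∸ k))) (f (suc n)) ⟩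
  f (suc n) ⊕ sumTo n (λ k → f (n ∸ k))  ≡⟨ sym (sumTo-suc n (λ k → f (suc n ∸ k))) ⟩
  sumTo (suc n) (λ k → f (suc n ∸ k))    ∎

sumTo-triangle : ∀ n (G : ℕ → ℕ → ℚ√5) →
  sumTo n (λ k → sumTo k (λ i → G i k)) ≡ sumTo n (λ i → sumTo (n ∸ i) (λ t → G i (i + t)))
sumTo-triangle zero    G = refl
sumTo-triangle (suc n) G = begin
  sumTo n (λ k → sumTo k (λ i → G i k)) ⊕ (column ⊕ G (suc n) (suc n))
    ≡⟨ cong (_⊕ (column ⊕ G (suc n) (suc n))) (sumTo-triangle n G) ⟩
  rows n ⊕ (column ⊕ G (suc n) (suc n))
    ≡⟨ sym (⊕-assoc (rows n) column (G (suc n) (suc n))) ⟩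
  (rows n ⊕ column) ⊕ G (suc n) (suc n)
    ≡⟨ cong₂ _⊕_ (sym (sumTo-⊕ n (row n) (λ i → G i (suc n)))) (cong (G (suc n)) (sym (ℕ.+-identityʳ (suc n)))) ⟩
  sumTo n (λ i → row n i ⊕ G i (suc n)) ⊕ G (suc n) (suc n + 0)
    ≡⟨ cong₂ _⊕_ (sumTo-cong n extend-row) (cong (λ m → sumTo m (λ t → G (suc n) (suc n + t))) (sym (ℕ.n∸n≡0 n))) ⟩
  rows (suc n) ∎
  where
  row : ℕ → ℕ → ℚ√5
  row m i = sumTo (m ∸ i) (λ t → G i (i + t))
  rows : ℕ → ℚ√5
  rows m = sumTo m (row m)
  column : ℚ√5
  column = sumTo n (λ i → G i (suc n))
  extend-row : ∀ i → i ≤ n → row n i ⊕ G i (suc n) ≡ row (suc n) i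
  extend-row i i≤n = begin
    row n i ⊕ G i (suc n)                    ≡⟨ cong (λ m → row n i ⊕ G i m) (ℕ.m+[n∸m]≡n {i} (ℕ.m≤n⇒m≤1+n i≤n)) ⟨
    row n i ⊕ G i (i + (suc n ∸ i))          ≡⟨ cong (λ m → row n i ⊕ G i (i + m)) (ℕ.+-∸-assoc 1 i≤n) ⟩
    sumTo (suc (n ∸ i)) (λ t → G i (i + t))  ≡⟨ cong (λ m → sumTo m (λ t → G i (i + t))) (ℕ.+-∸-assoc 1 i≤n) ⟨
    row (suc n) i                            ∎

nCk*k!*[n∸k]!≡n! : ∀ {n k} → k ≤ n → (n C k) * (k ! * (n ∸ k) !) ≡ n !
nCk*k!*[n∸k]!≡n! {n} {k} k≤n = trans (cong (_* (k ! * (n ∸ k) !)) (nCk≡n!/k![n-k]! k≤n))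
  (m/n*n≡m {{k !* (n ∸ k) !≢0}} (k![n∸k]!∣n! k≤n))

nC[i+t]*[i+t]Ci≡nCi*[n∸i]Ct : ∀ n i t → i + t ≤ n → (n C (i + t)) * ((i + t) C i) ≡ (n C i) * ((n ∸ i) C t)
nC[i+t]*[i+t]Ci≡nCi*[n∸i]Ct n i t i+t≤n =
  ℕ.*-cancelʳ-≡ _ _ (i ! * (t ! * r !)) {{ℕ.m*n≢0 (i !) (t ! * r !) {{i !≢0}} {{t !* r !≢0}}}} (trans lhs (sym rhs))
  where
  r : ℕ
  r = n ∸ (i + t)
  lhs : (n C (i + t)) * ((i + t) C i) * (i ! * (t ! * r !)) ≡ n !
  lhs = begin
    (n C (i + t)) * ((i + t) C i) * (i ! * (t ! * r !))
      ≡⟨ rearrange (n C (i + t)) ((i + t) C i) (i !) (t !) (r !) ⟩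
    (n C (i + t)) * (((i + t) C i) * (i ! * t !) * r !)
      ≡⟨ cong (λ m → (n C (i + t)) * (((i + t) C i) * (i ! * m !) * r !)) (ℕ.m+n∸m≡n i t) ⟨
    (n C (i + t)) * (((i + t) C i) * (i ! * ((i + t) ∸ i) !) * r !)
      ≡⟨ cong (λ m → (n C (i + t)) * (m * r !)) (nCk*k!*[n∸k]!≡n! (ℕ.m≤m+n i t)) ⟩
    (n C (i + t)) * ((i + t) ! * r !)
      ≡⟨ nCk*k!*[n∸k]!≡n! i+t≤n ⟩
    n ! ∎
    where
    rearrange : ∀ a b c d e → a * b * (c * (d * e)) ≡ a * (b * (c * d) * e)
    rearrange = solve-∀ ℕ-ring
  t≤n∸i : t ≤ n ∸ i
  t≤n∸i = subst (_≤ n ∸ i) (ℕ.m+n∸m≡n i t) (ℕ.∸-monoˡ-≤ i i+t≤n)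
  rhs : (n C i) * ((n ∸ i) C t) * (i ! * (t ! * r !)) ≡ n !
  rhs = begin
    (n C i) * ((n ∸ i) C t) * (i ! * (t ! * r !))
      ≡⟨ rearrange (n C i) ((n ∸ i) C t) (i !) (t !) (r !) ⟩
    (n C i) * (i ! * (((n ∸ i) C t) * (t ! * r !)))
      ≡⟨ cong (λ m → (n C i) * (i ! * (((n ∸ i) C t) * (t ! * m !)))) (ℕ.∸-+-assoc n i t) ⟨
    (n C i) * (i ! * (((n ∸ i) C t) * (t ! * ((n ∸ i) ∸ t) !)))
      ≡⟨ cong (λ m → (n C i) * (i ! * m)) (nCk*k!*[n∸k]!≡n! t≤n∸i) ⟩
    (n C i) * (i ! * (n ∸ i) !)
      ≡⟨ nCk*k!*[n∸k]!≡n! (ℕ.≤-trans (ℕ.m≤m+n i t) i+t≤n) ⟩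
    n ! ∎
    where
    rearrange : ∀ a b c d e → a * b * (c * (d * e)) ≡ a * (c * (b * (d * e)))
    rearrange = solve-∀ ℕ-ring

B : ℕ → ℚ√5
B k = ι (bernoulli k)

weighted′ : ℕ → ℕ → List ℚ → ℚ
weighted′ m k []       = 0ℚ
weighted′ m k (b ∷ bs) = toℚ (suc m C k) ℚ.* b ℚ.+ weighted′ m (suc k) bs

weighted′-unique : ∀ m (F : ℕ → List ℚ → ℚ) → (∀ k → F k [] ≡ 0ℚ) →
  (∀ k b bs → F k (b ∷ bs) ≡ toℚ (suc m C k) ℚ.* b ℚ.+ F (suc k) bs) →
  ∀ k xs → F k xs ≡ weighted′ m k xs
weighted′-unique m F F-[] F-∷ k []       = F-[] k
weighted′-unique m F F-[] F-∷ k (b ∷ bs) =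
  trans (F-∷ k b bs) (cong (toℚ (suc m C k) ℚ.* b ℚ.+_) (weighted′-unique m F F-[] F-∷ (suc k) bs))

weighted′-head : ∀ m k x → ι (toℚ (suc m C k) ℚ.* x) ≡ fromℕ (suc m C (k + 0)) ⊗ ι x
weighted′-head m k x = trans (ι-homo-* (toℚ (suc m C k)) x)
  (cong (λ i → fromℕ (suc m C i) ⊗ ι x) (sym (ℕ.+-identityʳ k)))

weighted′-as-sumTo : ∀ m n k (xs : List ℚ) → length xs ≡ suc n →
  ι (weighted′ m k xs) ≡ sumTo n (λ i → fromℕ (suc m C (k + i)) ⊗ ι (nth xs i))
weighted′-as-sumTo m zero    k (x ∷ [])     _   =
  trans (cong ι (ℚ.+-identityʳ (toℚ (suc m C k) ℚ.* x))) (weighted′-head m k x)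
weighted′-as-sumTo m (suc n) k (x ∷ y ∷ ys) len = begin
  ι (toℚ (suc m C k) ℚ.* x) ⊕ ι (weighted′ m (suc k) (y ∷ ys))
    ≡⟨ cong₂ _⊕_ (weighted′-head m k x) (weighted′-as-sumTo m n (suc k) (y ∷ ys) (ℕ.suc-injective len)) ⟩
  f 0 ⊕ sumTo n (λ i → fromℕ (suc m C (suc k + i)) ⊗ ι (nth (y ∷ ys) i))
    ≡⟨ cong (f 0 ⊕_) (sumTo-cong n (λ i _ → cong (λ j → fromℕ (suc m C j) ⊗ ι (nth (y ∷ ys) i)) (sym (ℕ.+-suc k i)))) ⟩
  f 0 ⊕ sumTo n (f ∘ suc)
    ≡⟨ sym (sumTo-suc n f) ⟩
  sumTo (suc n) f ∎
  where
  f : ℕ → ℚ√5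
  f i = fromℕ (suc m C (k + i)) ⊗ ι (nth (x ∷ y ∷ ys) i)

bernList-suc : ∀ n → Σ[ w ∈ ℚ ] bernList (suc n) ≡ bernList n ++ [ ℚ.- ((+ 1 ℚ./ suc (suc n)) ℚ.* w) ]
bernList-suc n = _ , refl

-- The weighted sum in the recursion of bernList is private to Defs; abstracting
-- its arguments exposes it to unification as the F of weighted′-unique.
bernList-suc-weight : ∀ n → proj₁ (bernList-suc n) ≡ weighted′ (suc n) 0 (bernList n)
bernList-suc-weight n with bernList n | 0 | weighted′-unique (suc n) _ (λ _ → refl) (λ _ _ _ → refl)
... | xs | k | unique = unique k xs

length-bernList : ∀ n → length (bernList n) ≡ suc n
length-bernList zero    = refl
length-bernList (suc n) = trans (List.length-++ (bernList n)) (trans (cong (_+ 1) (length-bernList n)) (ℕ.+-comm (suc n) 1))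

nth-++ˡ : ∀ (xs ys : List ℚ) {k} → k < length xs → nth (xs ++ ys) k ≡ nth xs k
nth-++ˡ (x ∷ xs) ys {zero}  _         = refl
nth-++ˡ (x ∷ xs) ys {suc k} (s≤s k<n) = nth-++ˡ xs ys k<n

nth-++-length : ∀ (xs : List ℚ) y → nth (xs ++ [ y ]) (length xs) ≡ y
nth-++-length []       y = refl
nth-++-length (x ∷ xs) y = nth-++-length xs y

nth-bernList : ∀ {n k} → k ≤ n → nth (bernList n) k ≡ bernoulli k
nth-bernList {zero}  z≤n = refl
nth-bernList {suc n} k≤1+n with ℕ.m≤n⇒m<n∨m≡n k≤1+n
... | inj₂ refl       = refl
... | inj₁ (s≤s k≤n) =
  trans (nth-++ˡ (bernList n) _ (subst (_ <_) (sym (length-bernList n)) (s≤s k≤n))) (nth-bernList k≤n)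

bernoulli-suc : ∀ n → bernoulli (suc n) ≡ ℚ.- ((+ 1 ℚ./ suc (suc n)) ℚ.* weighted′ (suc n) 0 (bernList n))
bernoulli-suc n = begin
  nth (bernList n ++ [ last ]) (suc n)
    ≡⟨ cong (nth (bernList n ++ [ last ])) (length-bernList n) ⟨
  nth (bernList n ++ [ last ]) (length (bernList n))
    ≡⟨ nth-++-length (bernList n) last ⟩
  last
    ≡⟨ cong (λ w → ℚ.- ((+ 1 ℚ./ suc (suc n)) ℚ.* w)) (bernList-suc-weight n) ⟩
  ℚ.- ((+ 1 ℚ./ suc (suc n)) ℚ.* weighted′ (suc n) 0 (bernList n)) ∎
  where
  last : ℚ
  last = ℚ.- ((+ 1 ℚ./ suc (suc n)) ℚ.* proj₁ (bernList-suc n))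

toℚ[1+m]*1/[1+m]≡1 : ∀ m → toℚ (suc m) ℚ.* (+ 1 ℚ./ suc m) ≡ 1ℚ
toℚ[1+m]*1/[1+m]≡1 m = begin
  toℚ (suc m) ℚ.* (+ 1 ℚ./ suc m)
    ≡⟨ cong₂ ℚ._*_ (toℚ≡mkℚ (suc m)) (ℚ.normalize-coprime (1-coprimeTo (suc m))) ⟩
  p ℚ.* ℚ.1/ p
    ≡⟨ ℚ.*-inverseʳ p ⟩
  1ℚ ∎
  where
  p : ℚ
  p = mkℚ (+ suc m) 0 (Coprime.sym (1-coprimeTo (suc m)))

bernoulli-recurrence : ∀ n → sumTo (suc n) (λ k → fromℕ (suc (suc n) C k) ⊗ B k) ≡ 𝟘
bernoulli-recurrence n = begin
  sumTo n (λ k → fromℕ (d C k) ⊗ B k) ⊕ fromℕ (d C suc n) ⊗ B (suc n)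
    ≡⟨ cong₂ _⊕_ earlier last ⟩
  ι w ⊕ fromℕ d ⊗ ι (ℚ.- (c ℚ.* w))
    ≡⟨ cong (ι w ⊕_) (ι-homo-* (toℚ d) (ℚ.- (c ℚ.* w))) ⟨
  ι (w ℚ.+ toℚ d ℚ.* ℚ.- (c ℚ.* w))
    ≡⟨ cong ι (cancel w (toℚ d) c (toℚ[1+m]*1/[1+m]≡1 (suc n))) ⟩
  𝟘 ∎
  where
  d : ℕ
  d = suc (suc n)
  c : ℚ
  c = + 1 ℚ./ d
  w : ℚ
  w = weighted′ (suc n) 0 (bernList n)
  earlier : sumTo n (λ k → fromℕ (d C k) ⊗ B k) ≡ ι w
  earlier = trans (sumTo-cong n (λ k k≤n → cong (λ b → fromℕ (d C k) ⊗ ι b) (sym (nth-bernList k≤n))))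
                  (sym (weighted′-as-sumTo (suc n) n 0 (bernList n) (length-bernList n)))
  last : fromℕ (d C suc n) ⊗ B (suc n) ≡ fromℕ d ⊗ ι (ℚ.- (c ℚ.* w))
  last = cong₂ (λ a b → fromℕ a ⊗ ι b)
    (trans (nCk≡nC[n∸k] (ℕ.n≤1+n (suc n))) (trans (cong (d C_) (ℕ.m+n∸n≡m 1 n)) (nC1≡n d)))
    (bernoulli-suc n)
  cancel : ∀ w d c → d ℚ.* c ≡ 1ℚ → w ℚ.+ d ℚ.* ℚ.- (c ℚ.* w) ≡ 0ℚ
  cancel w d c dc≡1 = begin
    w ℚ.+ d ℚ.* ℚ.- (c ℚ.* w)  ≡⟨ expand w d c ⟩
    w ℚ.- d ℚ.* c ℚ.* w        ≡⟨ cong (λ x → w ℚ.- x ℚ.* w) dc≡1 ⟩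
    w ℚ.- 1ℚ ℚ.* w             ≡⟨ annihilate w ⟩
    0ℚ                         ∎
    where
    expand : ∀ w d c → w ℚ.+ d ℚ.* ℚ.- (c ℚ.* w) ≡ w ℚ.- d ℚ.* c ℚ.* w
    expand = solve-∀ ℚ-ring
    annihilate : ∀ w → w ℚ.- 1ℚ ℚ.* w ≡ 0ℚ
    annihilate = solve-∀ ℚ-ring

δ₁ : ℕ → ℚ√5
δ₁ 1 = 𝟙
δ₁ _ = 𝟘

sumTo-binomial-bernoulli : ∀ m → sumTo m (λ k → fromℕ (m C k) ⊗ B (m ∸ k)) ≡ B m ⊕ δ₁ m
sumTo-binomial-bernoulli zero          = refl
sumTo-binomial-bernoulli (suc zero)    = refl
sumTo-binomial-bernoulli (suc (suc n)) = begin
  sumTo m (λ k → fromℕ (m C k) ⊗ B (m ∸ k))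
    ≡⟨ sumTo-reverse m _ ⟩
  sumTo m (λ k → fromℕ (m C (m ∸ k)) ⊗ B (m ∸ (m ∸ k)))
    ≡⟨ sumTo-cong m (λ k k≤m → cong₂ (λ a b → fromℕ a ⊗ B b) (sym (nCk≡nC[n∸k] k≤m)) (ℕ.m∸[m∸n]≡n k≤m)) ⟩
  sumTo (suc n) (λ k → fromℕ (m C k) ⊗ B k) ⊕ fromℕ (m C m) ⊗ B m
    ≡⟨ cong₂ _⊕_ (bernoulli-recurrence n) (cong (λ a → fromℕ a ⊗ B m) (nCn≡1 m)) ⟩
  𝟘 ⊕ 𝟙 ⊗ B m
    ≡⟨ trans (⊕-identityˡ (𝟙 ⊗ B m)) (trans (⊗-identityˡ (B m)) (sym (⊕-identityʳ (B m)))) ⟩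
  B m ⊕ 𝟘 ∎
  where
  m : ℕ
  m = suc (suc n)

bernCoeff : ℕ → ℚ√5 → ℕ → ℚ√5
bernCoeff n g k = fromℕ (n C k) ⊗ B (n ∸ k) ⊗ g ^√ (n ∸ k)

bernPoly : ℕ → ℚ√5 → ℚ√5 → ℚ√5
bernPoly n g x = sumTo n (λ k → bernCoeff n g k ⊗ x ^√ k)

sumTo-⊗δ₁ : ∀ p (A : ℕ → ℚ√5) → sumTo (suc p) (λ i → A i ⊗ δ₁ (suc p ∸ i)) ≡ A p
sumTo-⊗δ₁ zero    A = pick (A 0) (A 1)
  where
  pick : ∀ a b → a ⊗ 𝟙 ⊕ b ⊗ 𝟘 ≡ a
  pick = solve-∀ ℚ√5-ring
sumTo-⊗δ₁ (suc p) A = begin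
  sumTo (suc (suc p)) (λ i → A i ⊗ δ₁ (suc (suc p) ∸ i))      ≡⟨ sumTo-suc (suc p) _ ⟩
  A 0 ⊗ 𝟘 ⊕ sumTo (suc p) (λ i → A (suc i) ⊗ δ₁ (suc p ∸ i))  ≡⟨ cong (A 0 ⊗ 𝟘 ⊕_) (sumTo-⊗δ₁ p (A ∘ suc)) ⟩
  A 0 ⊗ 𝟘 ⊕ A (suc p)                                         ≡⟨ drop (A 0) (A (suc p)) ⟩
  A (suc p)                                                   ∎
  where
  drop : ∀ a b → a ⊗ 𝟘 ⊕ b ≡ b
  drop = solve-∀ ℚ√5-ring

sumTo-binomialTerm-⊗δ₁ : ∀ n x y → sumTo n (λ i → binomialTerm n x y i ⊗ δ₁ (n ∸ i)) ≡ fromℕ n ⊗ y ⊗ x ^√ (n ∸ 1)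
sumTo-binomialTerm-⊗δ₁ zero    x y = vanish (binomialTerm 0 x y 0) y
  where
  vanish : ∀ a y → a ⊗ 𝟘 ≡ 𝟘 ⊗ y ⊗ 𝟙
  vanish = solve-∀ ℚ√5-ring
sumTo-binomialTerm-⊗δ₁ (suc p) x y = begin
  sumTo (suc p) (λ i → binomialTerm (suc p) x y i ⊗ δ₁ (suc p ∸ i))
    ≡⟨ sumTo-⊗δ₁ p (binomialTerm (suc p) x y) ⟩
  fromℕ (suc p C p) ⊗ (x ^√ p ⊗ y ^√ (suc p ∸ p))
    ≡⟨ cong₂ (λ c m → fromℕ c ⊗ (x ^√ p ⊗ y ^√ m)) [1+p]Cp≡1+p (ℕ.m+n∸n≡m 1 p) ⟩
  fromℕ (suc p) ⊗ (x ^√ p ⊗ (y ⊗ 𝟙))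
    ≡⟨ rearrange (fromℕ (suc p)) (x ^√ p) y ⟩
  fromℕ (suc p) ⊗ y ⊗ x ^√ p ∎
  where
  [1+p]Cp≡1+p : suc p C p ≡ suc p
  [1+p]Cp≡1+p = trans (nCk≡nC[n∸k] (ℕ.n≤1+n p)) (trans (cong (suc p C_) (ℕ.m+n∸n≡m 1 p)) (nC1≡n (suc p)))
  rearrange : ∀ a b y → a ⊗ (b ⊗ (y ⊗ 𝟙)) ≡ a ⊗ y ⊗ b
  rearrange = solve-∀ ℚ√5-ring

bernCoeff-⊗-binomialTerm : ∀ n g x i t → i + t ≤ n →
  bernCoeff n g (i + t) ⊗ binomialTerm (i + t) x g i
    ≡ binomialTerm n x g i ⊗ (fromℕ ((n ∸ i) C t) ⊗ B (n ∸ i ∸ t))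
bernCoeff-⊗-binomialTerm n g x i t i+t≤n = begin
  fromℕ (n C k) ⊗ B (n ∸ k) ⊗ g ^√ (n ∸ k) ⊗ (fromℕ (k C i) ⊗ (x ^√ i ⊗ g ^√ (k ∸ i)))
    ≡⟨ regroup (fromℕ (n C k)) (fromℕ (k C i)) (B (n ∸ k)) (x ^√ i) (g ^√ (n ∸ k)) (g ^√ (k ∸ i)) ⟩
  (fromℕ (n C k) ⊗ fromℕ (k C i)) ⊗ (x ^√ i ⊗ (g ^√ (n ∸ k) ⊗ g ^√ (k ∸ i))) ⊗ B (n ∸ k)
    ≡⟨ cong₃ choose powers (cong B (ℕ.∸-+-assoc n i t)) ⟨
  (fromℕ (n C i) ⊗ fromℕ ((n ∸ i) C t)) ⊗ (x ^√ i ⊗ g ^√ (n ∸ i)) ⊗ B (n ∸ i ∸ t)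
    ≡⟨ ungroup (fromℕ (n C i)) (fromℕ ((n ∸ i) C t)) (x ^√ i ⊗ g ^√ (n ∸ i)) (B (n ∸ i ∸ t)) ⟩
  fromℕ (n C i) ⊗ (x ^√ i ⊗ g ^√ (n ∸ i)) ⊗ (fromℕ ((n ∸ i) C t) ⊗ B (n ∸ i ∸ t)) ∎
  where
  k : ℕ
  k = i + t
  cong₃ : ∀ {a a′ b b′ c c′} → a ≡ a′ → b ≡ b′ → c ≡ c′ → a ⊗ (x ^√ i ⊗ b) ⊗ c ≡ a′ ⊗ (x ^√ i ⊗ b′) ⊗ c′
  cong₃ refl refl refl = refl
  choose : fromℕ (n C i) ⊗ fromℕ ((n ∸ i) C t) ≡ fromℕ (n C k) ⊗ fromℕ (k C i)
  choose = begin
    fromℕ (n C i) ⊗ fromℕ ((n ∸ i) C t)  ≡⟨ fromℕ-homo-* (n C i) ((n ∸ i) C t) ⟨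
    fromℕ ((n C i) * ((n ∸ i) C t))      ≡⟨ cong fromℕ (nC[i+t]*[i+t]Ci≡nCi*[n∸i]Ct n i t i+t≤n) ⟨
    fromℕ ((n C k) * (k C i))            ≡⟨ fromℕ-homo-* (n C k) (k C i) ⟩
    fromℕ (n C k) ⊗ fromℕ (k C i)        ∎
  powers : g ^√ (n ∸ i) ≡ g ^√ (n ∸ k) ⊗ g ^√ (k ∸ i)
  powers = trans (cong (g ^√_) exponent) (^√-homo-⊗ g (n ∸ k) (k ∸ i))
    where
    exponent : n ∸ i ≡ n ∸ k + (k ∸ i)
    exponent = begin
      n ∸ i            ≡⟨ cong (_∸ i) (ℕ.m∸n+n≡m i+t≤n) ⟨
      n ∸ k + k ∸ i    ≡⟨ ℕ.+-∸-assoc (n ∸ k) (ℕ.m≤m+n i t) ⟩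
      n ∸ k + (k ∸ i)  ∎
  regroup : ∀ c c′ b y p q → c ⊗ b ⊗ p ⊗ (c′ ⊗ (y ⊗ q)) ≡ (c ⊗ c′) ⊗ (y ⊗ (p ⊗ q)) ⊗ b
  regroup = solve-∀ ℚ√5-ring
  ungroup : ∀ c c′ y b → (c ⊗ c′) ⊗ y ⊗ b ≡ c ⊗ y ⊗ (c′ ⊗ b)
  ungroup = solve-∀ ℚ√5-ring

bernPoly-shift : ∀ n g x → bernPoly n g (x ⊕ g) ≡ fromℕ n ⊗ g ⊗ x ^√ (n ∸ 1) ⊕ bernPoly n g x
bernPoly-shift n g x = begin
  bernPoly n g (x ⊕ g)
    ≡⟨ sumTo-cong n (λ k _ → expand k) ⟩
  sumTo n (λ k → sumTo k (λ i → bernCoeff n g k ⊗ binomialTerm k x g i))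
    ≡⟨ sumTo-triangle n (λ i k → bernCoeff n g k ⊗ binomialTerm k x g i) ⟩
  sumTo n (λ i → sumTo (n ∸ i) (λ t → bernCoeff n g (i + t) ⊗ binomialTerm (i + t) x g i))
    ≡⟨ sumTo-cong n (λ i i≤n → sumTo-cong (n ∸ i) (λ t t≤n∸i →
         bernCoeff-⊗-binomialTerm n g x i t (subst (_≤ n) (ℕ.+-comm t i) (ℕ.m≤o∸n⇒m+n≤o t i≤n t≤n∸i)))) ⟩
  sumTo n (λ i → sumTo (n ∸ i) (λ t → A i ⊗ (fromℕ ((n ∸ i) C t) ⊗ B (n ∸ i ∸ t))))
    ≡⟨ sumTo-cong n (λ i _ → trans (sumTo-⊗ˡ (n ∸ i) (A i) _) (cong (A i ⊗_) (sumTo-binomial-bernoulli (n ∸ i)))) ⟩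
  sumTo n (λ i → A i ⊗ (B (n ∸ i) ⊕ δ₁ (n ∸ i)))
    ≡⟨ trans (sumTo-cong n (λ i _ → ⊗-distribˡ-⊕ (A i) (B (n ∸ i)) (δ₁ (n ∸ i)))) (sumTo-⊕ n _ _) ⟩
  sumTo n (λ i → A i ⊗ B (n ∸ i)) ⊕ sumTo n (λ i → A i ⊗ δ₁ (n ∸ i))
    ≡⟨ cong₂ _⊕_ (sumTo-cong n (λ i _ → rearrange (fromℕ (n C i)) (x ^√ i) (g ^√ (n ∸ i)) (B (n ∸ i))))
                 (sumTo-binomialTerm-⊗δ₁ n x g) ⟩
  bernPoly n g x ⊕ fromℕ n ⊗ g ⊗ x ^√ (n ∸ 1)
    ≡⟨ ⊕-comm (bernPoly n g x) (fromℕ n ⊗ g ⊗ x ^√ (n ∸ 1)) ⟩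
  fromℕ n ⊗ g ⊗ x ^√ (n ∸ 1) ⊕ bernPoly n g x ∎
  where
  A : ℕ → ℚ√5
  A = binomialTerm n x g
  expand : ∀ k → bernCoeff n g k ⊗ (x ⊕ g) ^√ k ≡ sumTo k (λ i → bernCoeff n g k ⊗ binomialTerm k x g i)
  expand k = trans (cong (bernCoeff n g k ⊗_) (binomial k x g)) (sym (sumTo-⊗ˡ k (bernCoeff n g k) _))
  rearrange : ∀ c y p b → c ⊗ (y ⊗ p) ⊗ b ≡ c ⊗ b ⊗ p ⊗ y
  rearrange = solve-∀ ℚ√5-ring

-- Closed arithmetic in ℚ√5 computes: two ⊗ half, half ⊕ half and 1/√5 ⊗ √5 all
-- reduce to 𝟙, which several proofs below use silently.
two half : ℚ√5
two  = 𝟙 ⊕ 𝟙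
half = ι (+ 1 ℚ./ 2)

ι-two^[1-] : ∀ m → ι (two^[1- m ]) ≡ two ⊗ half ^√ m
ι-two^[1-] zero    = refl
ι-two^[1-] (suc m) = begin
  ι ((+ 1 ℚ./ 2) ^ℚ m)      ≡⟨ ι-homo-^ (+ 1 ℚ./ 2) m ⟩
  half ^√ m                 ≡⟨ ⊗-identityˡ (half ^√ m) ⟨
  (two ⊗ half) ⊗ half ^√ m  ≡⟨ ⊗-assoc two half (half ^√ m) ⟩
  two ⊗ half ^√ suc m       ∎

bernPoly-sub : ∀ n g x y → sumTo n (λ k → bernCoeff n g k ⊗ (x ^√ k ⊕ ⊖ y ^√ k)) ≡ bernPoly n g x ⊕ ⊖ bernPoly n g y
bernPoly-sub n g x y = begin
  sumTo n (λ k → c k ⊗ (x ^√ k ⊕ ⊖ y ^√ k))          ≡⟨ sumTo-cong n (λ k _ → distrib (c k) (x ^√ k) (y ^√ k)) ⟩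
  sumTo n (λ k → c k ⊗ x ^√ k ⊕ ⊖ (c k ⊗ y ^√ k))    ≡⟨ sumTo-⊕ n _ _ ⟩
  bernPoly n g x ⊕ sumTo n (λ k → ⊖ (c k ⊗ y ^√ k))  ≡⟨ cong (bernPoly n g x ⊕_) (sumTo-⊖ n _) ⟩
  bernPoly n g x ⊕ ⊖ bernPoly n g y                  ∎
  where
  c : ℕ → ℚ√5
  c = bernCoeff n g
  distrib : ∀ c a b → c ⊗ (a ⊕ ⊖ b) ≡ c ⊗ a ⊕ ⊖ (c ⊗ b)
  distrib = solve-∀ ℚ√5-ring

bernPoly-midpoint : ∀ n v h → let g = h ⊗ half in
  two ⊗ (bernPoly n g (v ⊕ h) ⊕ ⊖ bernPoly n g v) ⊕ ⊖ (bernPoly n h (v ⊕ h) ⊕ ⊖ bernPoly n h v)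
    ≡ fromℕ n ⊗ h ⊗ (v ⊕ g) ^√ (n ∸ 1)
bernPoly-midpoint n v h = begin
  two ⊗ (P g (v ⊕ h) ⊕ ⊖ P g v) ⊕ ⊖ (P h (v ⊕ h) ⊕ ⊖ P h v)
    ≡⟨ cong₂ (λ a b → two ⊗ (a ⊕ ⊖ P g v) ⊕ ⊖ (b ⊕ ⊖ P h v)) shift-g-twice (bernPoly-shift n h v) ⟩
  two ⊗ ((N ⊗ g ⊗ W ⊕ (N ⊗ g ⊗ V ⊕ P g v)) ⊕ ⊖ P g v) ⊕ ⊖ ((N ⊗ h ⊗ V ⊕ P h v) ⊕ ⊖ P h v)
    ≡⟨ collect N h half W V (P g v) (P h v) ⟩
  N ⊗ h ⊗ W ⊗ (two ⊗ half) ⊕ N ⊗ h ⊗ V ⊗ (two ⊗ half ⊕ ⊖ 𝟙)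
    ≡⟨ unit (N ⊗ h ⊗ W) (N ⊗ h ⊗ V) ⟩
  N ⊗ h ⊗ W ∎
  where
  g : ℚ√5
  g = h ⊗ half
  P : ℚ√5 → ℚ√5 → ℚ√5
  P = bernPoly n
  N : ℚ√5
  N = fromℕ n
  W : ℚ√5
  W = (v ⊕ g) ^√ (n ∸ 1)
  V : ℚ√5
  V = v ^√ (n ∸ 1)
  shift-g-twice : P g (v ⊕ h) ≡ N ⊗ g ⊗ W ⊕ (N ⊗ g ⊗ V ⊕ P g v)
  shift-g-twice = begin
    P g (v ⊕ h)                      ≡⟨ cong (λ w → P g (v ⊕ w)) (trans (sym (⊗-identityʳ h)) (⊗-distribˡ-⊕ h half half)) ⟩
    P g (v ⊕ (g ⊕ g))                ≡⟨ cong (P g) (⊕-assoc v g g) ⟨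
    P g ((v ⊕ g) ⊕ g)                ≡⟨ bernPoly-shift n g (v ⊕ g) ⟩
    N ⊗ g ⊗ W ⊕ P g (v ⊕ g)          ≡⟨ cong (N ⊗ g ⊗ W ⊕_) (bernPoly-shift n g v) ⟩
    N ⊗ g ⊗ W ⊕ (N ⊗ g ⊗ V ⊕ P g v)  ∎
  collect : ∀ N h t W V p q → two ⊗ ((N ⊗ (h ⊗ t) ⊗ W ⊕ (N ⊗ (h ⊗ t) ⊗ V ⊕ p)) ⊕ ⊖ p) ⊕ ⊖ ((N ⊗ h ⊗ V ⊕ q) ⊕ ⊖ q)
    ≡ N ⊗ h ⊗ W ⊗ (two ⊗ t) ⊕ N ⊗ h ⊗ V ⊗ (two ⊗ t ⊕ ⊖ 𝟙)
  collect = solve-∀ ℚ√5-ring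
  unit : ∀ a b → a ⊗ 𝟙 ⊕ b ⊗ (𝟙 ⊕ ⊖ 𝟙) ≡ a
  unit = solve-∀ ℚ√5-ring

bernoulli-midpoint-identity : ∀ n v h →
  sumTo n (λ k → fromℕ (n C k) ⊗ h ^√ (n ∸ k) ⊗ ι (two^[1- (n ∸ k) ] - 1ℚ) ⊗ ((v ⊕ h) ^√ k ⊕ ⊖ v ^√ k) ⊗ B (n ∸ k))
    ≡ fromℕ n ⊗ h ⊗ (v ⊕ h ⊗ half) ^√ (n ∸ 1)
bernoulli-midpoint-identity n v h = begin
  sumTo n (λ k → fromℕ (n C k) ⊗ h ^√ (n ∸ k) ⊗ ι (two^[1- (n ∸ k) ] - 1ℚ) ⊗ D k ⊗ B (n ∸ k))
    ≡⟨ sumTo-cong n (λ k _ → split k) ⟩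
  sumTo n (λ k → two ⊗ (bernCoeff n g k ⊗ D k) ⊕ ⊖ (bernCoeff n h k ⊗ D k))
    ≡⟨ sumTo-⊕ n _ _ ⟩
  sumTo n (λ k → two ⊗ (bernCoeff n g k ⊗ D k)) ⊕ sumTo n (λ k → ⊖ (bernCoeff n h k ⊗ D k))
    ≡⟨ cong₂ _⊕_ (sumTo-⊗ˡ n two _) (sumTo-⊖ n _) ⟩
  two ⊗ sumTo n (λ k → bernCoeff n g k ⊗ D k) ⊕ ⊖ sumTo n (λ k → bernCoeff n h k ⊗ D k)
    ≡⟨ cong₂ (λ a b → two ⊗ a ⊕ ⊖ b) (bernPoly-sub n g (v ⊕ h) v) (bernPoly-sub n h (v ⊕ h) v) ⟩
  two ⊗ (bernPoly n g (v ⊕ h) ⊕ ⊖ bernPoly n g v) ⊕ ⊖ (bernPoly n h (v ⊕ h) ⊕ ⊖ bernPoly n h v)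
    ≡⟨ bernPoly-midpoint n v h ⟩
  fromℕ n ⊗ h ⊗ (v ⊕ g) ^√ (n ∸ 1) ∎
  where
  g : ℚ√5
  g = h ⊗ half
  D : ℕ → ℚ√5
  D k = (v ⊕ h) ^√ k ⊕ ⊖ v ^√ k
  split : ∀ k → fromℕ (n C k) ⊗ h ^√ (n ∸ k) ⊗ ι (two^[1- (n ∸ k) ] - 1ℚ) ⊗ D k ⊗ B (n ∸ k)
              ≡ two ⊗ (bernCoeff n g k ⊗ D k) ⊕ ⊖ (bernCoeff n h k ⊗ D k)
  split k = begin
    c ⊗ h ^√ m ⊗ ι (two^[1- m ] - 1ℚ) ⊗ D k ⊗ B m
      ≡⟨ cong (λ t → c ⊗ h ^√ m ⊗ (t ⊕ ⊖ 𝟙) ⊗ D k ⊗ B m) (ι-two^[1-] m) ⟩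
    c ⊗ h ^√ m ⊗ (two ⊗ half ^√ m ⊕ ⊖ 𝟙) ⊗ D k ⊗ B m
      ≡⟨ expand c (h ^√ m) (half ^√ m) (D k) (B m) ⟩
    two ⊗ (c ⊗ B m ⊗ (h ^√ m ⊗ half ^√ m) ⊗ D k) ⊕ ⊖ (c ⊗ B m ⊗ h ^√ m ⊗ D k)
      ≡⟨ cong (λ p → two ⊗ (c ⊗ B m ⊗ p ⊗ D k) ⊕ ⊖ (c ⊗ B m ⊗ h ^√ m ⊗ D k)) (^√-distrib-⊗ h half m) ⟨
    two ⊗ (bernCoeff n g k ⊗ D k) ⊕ ⊖ (bernCoeff n h k ⊗ D k) ∎
    where
    c : ℚ√5
    c = fromℕ (n C k)
    m : ℕ
    m = n ∸ k
    expand : ∀ c p q d b → c ⊗ p ⊗ (two ⊗ q ⊕ ⊖ 𝟙) ⊗ d ⊗ b ≡ two ⊗ (c ⊗ b ⊗ (p ⊗ q) ⊗ d) ⊕ ⊖ (c ⊗ b ⊗ p ⊗ d)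
    expand = solve-∀ ℚ√5-ring

golden-power : ∀ {r s} → r ⊗ r ≡ r ⊕ 𝟙 → r ≡ half ⊗ (𝟙 ⊕ s) →
  ∀ n → r ^√ n ≡ half ⊗ (fromℕ (lucas n) ⊕ fromℕ (fib n) ⊗ s)
golden-power {s = s} _ _ zero = pad half (fromℕ 2) s
  where
  pad : ∀ t a s → t ⊗ a ≡ t ⊗ (a ⊕ 𝟘 ⊗ s)
  pad = solve-∀ ℚ√5-ring
golden-power {r} {s} _ r≡ (suc zero) =
  trans (⊗-identityʳ r) (trans r≡ (cong (λ z → half ⊗ (𝟙 ⊕ z)) (sym (⊗-identityˡ s))))
golden-power {r} {s} r²≡r+1 r≡ (suc (suc n)) = begin
  r ⊗ (r ⊗ r ^√ n)     ≡⟨ ⊗-assoc r r (r ^√ n) ⟨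
  (r ⊗ r) ⊗ r ^√ n     ≡⟨ cong (_⊗ r ^√ n) r²≡r+1 ⟩
  (r ⊕ 𝟙) ⊗ r ^√ n     ≡⟨ trans (⊗-distribʳ-⊕ (r ^√ n) r 𝟙) (cong (r ^√ suc n ⊕_) (⊗-identityˡ (r ^√ n))) ⟩
  r ^√ suc n ⊕ r ^√ n  ≡⟨ cong₂ _⊕_ (golden-power r²≡r+1 r≡ (suc n)) (golden-power r²≡r+1 r≡ n) ⟩
  half ⊗ (fromℕ (lucas (suc n)) ⊕ fromℕ (fib (suc n)) ⊗ s) ⊕ half ⊗ (fromℕ (lucas n) ⊕ fromℕ (fib n) ⊗ s)
    ≡⟨ collect half (fromℕ (lucas (suc n))) (fromℕ (fib (suc n))) (fromℕ (lucas n)) (fromℕ (fib n)) s ⟩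
  half ⊗ ((fromℕ (lucas (suc n)) ⊕ fromℕ (lucas n)) ⊕ (fromℕ (fib (suc n)) ⊕ fromℕ (fib n)) ⊗ s)
    ≡⟨ cong₂ (λ a b → half ⊗ (a ⊕ b ⊗ s)) (fromℕ-homo-+ (lucas (suc n)) (lucas n)) (fromℕ-homo-+ (fib (suc n)) (fib n)) ⟨
  half ⊗ (fromℕ (lucas (suc (suc n))) ⊕ fromℕ (fib (suc (suc n))) ⊗ s) ∎
  where
  collect : ∀ t a b c d s → t ⊗ (a ⊕ b ⊗ s) ⊕ t ⊗ (c ⊕ d ⊗ s) ≡ t ⊗ ((a ⊕ c) ⊕ (b ⊕ d) ⊗ s)
  collect = solve-∀ ℚ√5-ring

φ ψ : ℚ√5
φ = half ⊗ (𝟙 ⊕ √5)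
ψ = half ⊗ (𝟙 ⊕ ⊖ √5)

binet-fib : ∀ m → φ ^√ m ⊕ ⊖ ψ ^√ m ≡ √5 ⊗ fromℕ (fib m)
binet-fib m = begin
  φ ^√ m ⊕ ⊖ ψ ^√ m                                ≡⟨ cong₂ (λ a b → a ⊕ ⊖ b) (golden-power refl refl m) (golden-power refl refl m) ⟩
  half ⊗ (L ⊕ F ⊗ √5) ⊕ ⊖ (half ⊗ (L ⊕ F ⊗ ⊖ √5))  ≡⟨ difference half L F √5 ⟩
  (two ⊗ half) ⊗ (√5 ⊗ F)                          ≡⟨ ⊗-identityˡ (√5 ⊗ F) ⟩
  √5 ⊗ F                                           ∎
  where
  L F : ℚ√5
  L = fromℕ (lucas m)
  F = fromℕ (fib m)
  difference : ∀ t l f s → t ⊗ (l ⊕ f ⊗ s) ⊕ ⊖ (t ⊗ (l ⊕ f ⊗ ⊖ s)) ≡ (two ⊗ t) ⊗ (s ⊗ f)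
  difference = solve-∀ ℚ√5-ring

binet-lucas : ∀ m → φ ^√ m ⊕ ψ ^√ m ≡ fromℕ (lucas m)
binet-lucas m = begin
  φ ^√ m ⊕ ψ ^√ m                              ≡⟨ cong₂ _⊕_ (golden-power refl refl m) (golden-power refl refl m) ⟩
  half ⊗ (L ⊕ F ⊗ √5) ⊕ half ⊗ (L ⊕ F ⊗ ⊖ √5)  ≡⟨ addition half L F √5 ⟩
  (two ⊗ half) ⊗ L                             ≡⟨ ⊗-identityˡ L ⟩
  L                                            ∎
  where
  L F : ℚ√5
  L = fromℕ (lucas m)
  F = fromℕ (fib m)
  addition : ∀ t l f s → t ⊗ (l ⊕ f ⊗ s) ⊕ t ⊗ (l ⊕ f ⊗ ⊖ s) ≡ (two ⊗ t) ⊗ l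
  addition = solve-∀ ℚ√5-ring

√5-cancelˡ : ∀ {x y} → √5 ⊗ x ≡ √5 ⊗ y → x ≡ y
√5-cancelˡ {x} {y} √5x≡√5y = begin
  x                ≡⟨ ⊗-identityˡ x ⟨
  (1/√5 ⊗ √5) ⊗ x  ≡⟨ ⊗-assoc 1/√5 √5 x ⟩
  1/√5 ⊗ (√5 ⊗ x)  ≡⟨ cong (1/√5 ⊗_) √5x≡√5y ⟩
  1/√5 ⊗ (√5 ⊗ y)  ≡⟨ ⊗-assoc 1/√5 √5 y ⟨
  (1/√5 ⊗ √5) ⊗ y  ≡⟨ ⊗-identityˡ y ⟩
  y                ∎
  where
  1/√5 : ℚ√5
  1/√5 = 0ℚ + (+ 1 ℚ./ 5) ·√5

√5-fib-* : ∀ j k → (ψ ^√ j ⊕ √5 ⊗ fromℕ (fib j)) ^√ k ⊕ ⊖ (ψ ^√ j) ^√ k ≡ √5 ⊗ fromℕ (fib (j * k))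
√5-fib-* j k = begin
  (ψ ^√ j ⊕ √5 ⊗ fromℕ (fib j)) ^√ k ⊕ ⊖ (ψ ^√ j) ^√ k
    ≡⟨ cong (λ u → u ^√ k ⊕ ⊖ (ψ ^√ j) ^√ k) (trans (cong (ψ ^√ j ⊕_) (sym (binet-fib j))) (add-back (φ ^√ j) (ψ ^√ j))) ⟩
  (φ ^√ j) ^√ k ⊕ ⊖ (ψ ^√ j) ^√ k
    ≡⟨ cong₂ (λ a b → a ⊕ ⊖ b) (^√-assocʳ φ j k) (^√-assocʳ ψ j k) ⟩
  φ ^√ (j * k) ⊕ ⊖ ψ ^√ (j * k)
    ≡⟨ binet-fib (j * k) ⟩
  √5 ⊗ fromℕ (fib (j * k)) ∎
  where
  add-back : ∀ a b → b ⊕ (a ⊕ ⊖ b) ≡ a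
  add-back = solve-∀ ℚ√5-ring

lucas-midpoint : ∀ j → ψ ^√ j ⊕ √5 ⊗ fromℕ (fib j) ⊗ half ≡ half ⊗ fromℕ (lucas j)
lucas-midpoint j = begin
  ψ ^√ j ⊕ √5 ⊗ fromℕ (fib j) ⊗ half             ≡⟨ cong (λ d → ψ ^√ j ⊕ d ⊗ half) (binet-fib j) ⟨
  ψ ^√ j ⊕ (φ ^√ j ⊕ ⊖ ψ ^√ j) ⊗ half            ≡⟨ average (φ ^√ j) (ψ ^√ j) half ⟩
  half ⊗ (φ ^√ j ⊕ ψ ^√ j) ⊕ ψ ^√ j ⊗ (𝟙 ⊕ ⊖ 𝟙)  ≡⟨ drop (half ⊗ (φ ^√ j ⊕ ψ ^√ j)) (ψ ^√ j) ⟩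
  half ⊗ (φ ^√ j ⊕ ψ ^√ j)                       ≡⟨ cong (half ⊗_) (binet-lucas j) ⟩
  half ⊗ fromℕ (lucas j)                         ∎
  where
  average : ∀ a b t → b ⊕ (a ⊕ ⊖ b) ⊗ t ≡ t ⊗ (a ⊕ b) ⊕ b ⊗ (𝟙 ⊕ ⊖ (two ⊗ t))
  average = solve-∀ ℚ√5-ring
  drop : ∀ a b → a ⊕ b ⊗ (𝟙 ⊕ ⊖ 𝟙) ≡ a
  drop = solve-∀ ℚ√5-ring

fromℕ-⊗-[half⊗b]^ : ∀ n a b →
  fromℕ n ⊗ a ⊗ (half ⊗ b) ^√ (n ∸ 1) ≡ fromℕ n ⊗ ι (two^[1- n ]) ⊗ a ⊗ b ^√ (n ∸ 1)
fromℕ-⊗-[half⊗b]^ zero    a b = vanish a (ι (two^[1- 0 ]))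
  where
  vanish : ∀ a t → 𝟘 ⊗ a ⊗ 𝟙 ≡ 𝟘 ⊗ t ⊗ a ⊗ 𝟙
  vanish = solve-∀ ℚ√5-ring
fromℕ-⊗-[half⊗b]^ (suc p) a b = begin
  fromℕ (suc p) ⊗ a ⊗ (half ⊗ b) ^√ p               ≡⟨ cong (fromℕ (suc p) ⊗ a ⊗_) (^√-distrib-⊗ half b p) ⟩
  fromℕ (suc p) ⊗ a ⊗ (half ^√ p ⊗ b ^√ p)          ≡⟨ regroup (fromℕ (suc p)) a (half ^√ p) (b ^√ p) ⟩
  fromℕ (suc p) ⊗ half ^√ p ⊗ a ⊗ b ^√ p            ≡⟨ cong (λ t → fromℕ (suc p) ⊗ t ⊗ a ⊗ b ^√ p) (ι-homo-^ (+ 1 ℚ./ 2) p) ⟨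
  fromℕ (suc p) ⊗ ι (two^[1- suc p ]) ⊗ a ⊗ b ^√ p  ∎
  where
  regroup : ∀ c a t y → c ⊗ a ⊗ (t ⊗ y) ≡ c ⊗ t ⊗ a ⊗ y
  regroup = solve-∀ ℚ√5-ring

corollary14 : (n j : ℕ) → j ≥ 1 →
    sumTo n (λ k →
      ι (toℚ (n C k)) ⊗ ((√5 ⊗ ι (toℚ (fib j))) ^√ (n ∸ k))
        ⊗ ι (two^[1- (n ∸ k) ] - 1ℚ) ⊗ ι (toℚ (fib (j * k))) ⊗ ι (bernoulli (n ∸ k)))
    ≡ ι (toℚ n) ⊗ ι (two^[1- n ]) ⊗ ι (toℚ (fib j)) ⊗ ι (toℚ (lucas j)) ^√ (n ∸ 1)
corollary14 n j _ = √5-cancelˡ (begin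
  √5 ⊗ sumTo n τ
    ≡⟨ sumTo-⊗ˡ n √5 τ ⟨
  sumTo n (λ k → √5 ⊗ τ k)
    ≡⟨ sumTo-cong n (λ k _ → move-√5 k) ⟩
  sumTo n (λ k → c k ⊗ h ^√ (n ∸ k) ⊗ t k ⊗ ((v ⊕ h) ^√ k ⊕ ⊖ v ^√ k) ⊗ B (n ∸ k))
    ≡⟨ bernoulli-midpoint-identity n v h ⟩
  fromℕ n ⊗ h ⊗ (v ⊕ h ⊗ half) ^√ (n ∸ 1)
    ≡⟨ cong (λ m → fromℕ n ⊗ h ⊗ m ^√ (n ∸ 1)) (lucas-midpoint j) ⟩
  fromℕ n ⊗ h ⊗ (half ⊗ L) ^√ (n ∸ 1)
    ≡⟨ fromℕ-⊗-[half⊗b]^ n h L ⟩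
  fromℕ n ⊗ ι (two^[1- n ]) ⊗ h ⊗ L ^√ (n ∸ 1)
    ≡⟨ pull-out √5 (fromℕ n ⊗ ι (two^[1- n ])) F (L ^√ (n ∸ 1)) ⟩
  √5 ⊗ (fromℕ n ⊗ ι (two^[1- n ]) ⊗ F ⊗ L ^√ (n ∸ 1)) ∎)
  where
  F L h v : ℚ√5
  F = fromℕ (fib j)
  L = fromℕ (lucas j)
  h = √5 ⊗ F
  v = ψ ^√ j
  c t : ℕ → ℚ√5
  c k = fromℕ (n C k)
  t k = ι (two^[1- (n ∸ k) ] - 1ℚ)
  τ : ℕ → ℚ√5
  τ k = c k ⊗ h ^√ (n ∸ k) ⊗ t k ⊗ fromℕ (fib (j * k)) ⊗ B (n ∸ k)
  move-√5 : ∀ k → √5 ⊗ τ k ≡ c k ⊗ h ^√ (n ∸ k) ⊗ t k ⊗ ((v ⊕ h) ^√ k ⊕ ⊖ v ^√ k) ⊗ B (n ∸ k)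
  move-√5 k = trans (commute √5 (c k) (h ^√ (n ∸ k)) (t k) (fromℕ (fib (j * k))) (B (n ∸ k)))
    (cong (λ d → c k ⊗ h ^√ (n ∸ k) ⊗ t k ⊗ d ⊗ B (n ∸ k)) (sym (√5-fib-* j k)))
    where
    commute : ∀ r a p q f b → r ⊗ (a ⊗ p ⊗ q ⊗ f ⊗ b) ≡ a ⊗ p ⊗ q ⊗ (r ⊗ f) ⊗ b
    commute = solve-∀ ℚ√5-ring
  pull-out : ∀ r a f y → a ⊗ (r ⊗ f) ⊗ y ≡ r ⊗ (a ⊗ f ⊗ y)
  pull-out = solve-∀ ℚ√5-ring
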